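{- Let $H$ be a connected $4$-uniform hypergraph of order $8$ and diameter $3$. Then $W(H)\le 44$, with equality if and only if $H$ has exactly $3$ hyperedges.
   Context: A hypergraph $H=(V,E)$ consists of a finite vertex set $V$ and a set $E$ of distinct subsets of $V$ (hyperedges); it is $4$-uniform if every hyperedge has exactly $4$ elements; its order is $|V|$. For $u,w\in V$, $d_H(u,w)$ is the least $\ell\ge0$ such that there are vertices $u=x_0,\dots,x_\ell=w$ with $x_{i-1},x_i$ in a common hyperedge for each $i$ ($\infty$ if none); $H$ is connected if all distances are finite; its diameter is $\max_{u,w}d_H(u,w)$. The Wiener index is $W(H)=\sum_{\{u,w\}\subseteq V,\,u\ne w} d_H(u,w)$. -}

module Defs where

open import Data.Nat using (ℕ; zero; suc; _≤_)
open import Data.Fin using (Fin; _<?_)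
open import Data.Fin.Subset using (Subset; _∈_; ∣_∣)
open import Data.List using (List; length; map; filter; allFin)
open import Data.Nat.ListAction using (sum)
open import Data.List.Relation.Unary.All using (All)
open import Data.List.Relation.Unary.Unique.Propositional using (Unique)
import Data.List.Membership.Propositional as LM
open import Data.Product using (Σ; _×_; ∃)
open import Relation.Binary.PropositionalEquality using (_≡_)

record Hypergraph (n : ℕ) : Set where
  constructor hypergraph
  field
    edges    : List (Subset n)
    distinct : Unique edges

open Hypergraph public

numEdges : ∀ {n} → Hypergraph n → ℕ
numEdges H = length (edges H)

IsUniform : ∀ {n} → ℕ → Hypergraph n → Set
IsUniform k H = All (λ e → ∣ e ∣ ≡ k) (edges H)

Adj : ∀ {n} → Hypergraph n → Fin n → Fin n → Set
Adj H u w = Σ (Subset _) λ e → (e LM.∈ edges H) × (u ∈ e) × (w ∈ e)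

data Walk {n : ℕ} (H : Hypergraph n) : Fin n → Fin n → ℕ → Set where
  here : ∀ {u} → Walk H u u zero
  step : ∀ {u v w ℓ} → Adj H u v → Walk H v w ℓ → Walk H u w (suc ℓ)

Connected : ∀ {n} → Hypergraph n → Set
Connected H = ∀ u w → ∃ λ ℓ → Walk H u w ℓ

IsDistance : ∀ {n} → Hypergraph n → (Fin n → Fin n → ℕ) → Set
IsDistance H d = ∀ u w → Walk H u w (d u w) × (∀ ℓ → Walk H u w ℓ → d u w ≤ ℓ)

HasDiameter : ∀ {n} → (Fin n → Fin n → ℕ) → ℕ → Set
HasDiameter d D = (∀ u w → d u w ≤ D) × ∃ λ u → ∃ λ w → d u w ≡ D

wiener : ∀ {n} → (Fin n → Fin n → ℕ) → ℕ
wiener {n} d = sum (map (λ u → sum (map (d u) (filter (u <?_) (allFin n)))) (allFin n))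

{-# OPTIONS --safe #-}
module Submission where

-- A diametral path u₀ –e₁– x –e₂– y –e₃– w₀ forces e₁ ∩ e₃ = ∅, so on 8 vertices with
-- 4-element edges e₃ is the complement of e₁. Already the three edges e₁, e₂, e₃ put
-- every pair at most at its skeleton distance: 1 on a common side of the partition
-- {e₁, e₃}, and across it 1, 2 or 3 according as two, one or no endpoints lie in e₂.
-- The skeleton distances add up to 44 whatever e₁ and e₂ are. If there are no other
-- edges, the skeleton distance is the distance; an edge other than e₁, e₂, e₃ is, by
-- uniformity, contained in none of them, so it joins a pair across the partition that
-- is not inside e₂, and shortens the distance of that pair.

open import Defs
open import Data.Nat using (ℕ; zero; suc; _+_; _∸_; _≤_; _<_; z≤n; s≤s)
open import Data.Nat.Properties
  using (≤-refl; ≤-trans; ≤-antisym; <-irrefl; +-mono-≤; +-mono-<-≤; +-mono-≤-<;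
         m+n∸n≡m; m∸n≤m; _≟_)
open import Data.Nat.ListAction using (sum)
open import Data.Fin using (Fin; _<?_) renaming (_<_ to _<ᶠ_)
open import Data.Fin.Properties using (any?; <-cmp; <⇒≢; injective⇒≤)
open import Data.Fin.Subset using (Subset; _∈_; _∉_; _⊆_; _⊈_; ∣_∣; ∁)
open import Data.Fin.Subset.Properties
  using (_∈?_; _⊆?_; ⊆-antisym; p⊂q⇒∣p∣<∣q∣; x∈p⇒x∉∁p; x∉p⇒x∈∁p; x∉∁p⇒x∈p; ∣∁p∣≡n∸∣p∣; anySubset?)
open import Data.List using (List; []; _∷_; length; lookup; map; filter; allFin)
open import Data.List.Membership.Propositional using () renaming (_∈_ to _∈ₗ_)
open import Data.List.Membership.Propositional.Properties using (∈-lookup; ∈-filter⁻; ∈-filter⁺; ∈-allFin)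
import Data.List.Membership.DecPropositional as DecMembership
open import Data.List.Relation.Binary.Subset.Propositional using () renaming (_⊆_ to _⊆ₗ_)
open import Data.List.Relation.Binary.Subset.Propositional.Properties using (∈-∷⁺ʳ)
open import Data.List.Relation.Unary.Any using (here; there; index)
open import Data.List.Relation.Unary.Any.Properties using (lookup-index)
import Data.List.Relation.Unary.All as All
open import Data.List.Relation.Unary.All.Properties using (¬Any⇒All¬)
open import Data.List.Relation.Unary.AllPairs using ([]; _∷_)
open import Data.List.Relation.Unary.Unique.Propositional using (Unique)
open import Data.Bool using (true; false; if_then_else_; _xor_) renaming (_≟_ to _≟ᵇ_)
open import Data.Vec.Properties using (≡-dec)
open import Data.Product using (_×_; _,_; proj₁; proj₂; ∃; ∃₂)
open import Data.Sum using (_⊎_; inj₁; inj₂)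
open import Function using (_∘_)
open import Function.Bundles using (_⇔_; mk⇔)
open import Function.Properties.Equivalence using () renaming (trans to ⇔-trans; sym to ⇔-sym)
open import Relation.Binary using (DecidableEquality; tri<; tri≈; tri>)
open import Relation.Binary.PropositionalEquality using (_≡_; _≢_; refl; sym; trans; cong; subst; module ≡-Reasoning)
open import Relation.Nullary using (Dec; does; yes; no; ¬_)
open import Relation.Nullary.Negation using (contradiction; contradiction₂)
open import Relation.Nullary.Decidable using (decidable-stable; toWitnessFalse; _×-dec_; ¬?)

module _ {A : Set} where

  Unique⇒lookup-injective : ∀ {xs : List A} → Unique xs → ∀ {i j} → lookup xs i ≡ lookup xs j → i ≡ j
  Unique⇒lookup-injective (_ ∷ _) {Fin.zero} {Fin.zero} _ = refl
  Unique⇒lookup-injective (x≢xs ∷ _) {Fin.zero} {Fin.suc j} eq =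
    contradiction eq (All.lookup x≢xs (∈-lookup j))
  Unique⇒lookup-injective (x≢xs ∷ _) {Fin.suc i} {Fin.zero} eq =
    contradiction (sym eq) (All.lookup x≢xs (∈-lookup i))
  Unique⇒lookup-injective (_ ∷ xs!) {Fin.suc i} {Fin.suc j} eq = cong Fin.suc (Unique⇒lookup-injective xs! eq)

  Unique-⊆⇒length≤ : ∀ {xs ys : List A} → Unique xs → xs ⊆ₗ ys → length xs ≤ length ys
  Unique-⊆⇒length≤ {xs} {ys} xs! xs⊆ys = injective⇒≤ {f = index ∘ xs⊆ys ∘ ∈-lookup} index-injective
    where
    index-injective : ∀ {i j} → index (xs⊆ys (∈-lookup i)) ≡ index (xs⊆ys (∈-lookup j)) → i ≡ j
    index-injective {i} {j} eq = Unique⇒lookup-injective xs! (begin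
      lookup xs i                            ≡⟨ lookup-index (xs⊆ys (∈-lookup i)) ⟩
      lookup ys (index (xs⊆ys (∈-lookup i))) ≡⟨ cong (lookup ys) eq ⟩
      lookup ys (index (xs⊆ys (∈-lookup j))) ≡⟨ lookup-index (xs⊆ys (∈-lookup j)) ⟨
      lookup xs j                            ∎)
      where open ≡-Reasoning

module _ {A : Set} (_≟_ : DecidableEquality A) {xs ys : List A} (xs! : Unique xs) (ys! : Unique ys)
         (ys⊆xs : ys ⊆ₗ xs) where
  open DecMembership _≟_ using () renaming (_∈?_ to _∈ₗ?_)

  Unique-⊇⇒length≡⇔⊆ : length xs ≡ length ys ⇔ xs ⊆ₗ ys
  Unique-⊇⇒length≡⇔⊆ = mk⇔ length≡⇒⊆ ⊆⇒length≡
    where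
    ⊆⇒length≡ : xs ⊆ₗ ys → length xs ≡ length ys
    ⊆⇒length≡ xs⊆ys = ≤-antisym (Unique-⊆⇒length≤ xs! xs⊆ys) (Unique-⊆⇒length≤ ys! ys⊆xs)

    length≡⇒⊆ : length xs ≡ length ys → xs ⊆ₗ ys
    length≡⇒⊆ eq {x} x∈xs = decidable-stable (x ∈ₗ? ys) λ x∉ys →
      <-irrefl (sym eq) (Unique-⊆⇒length≤ (¬Any⇒All¬ ys x∉ys ∷ ys!) (∈-∷⁺ʳ x∈xs ys⊆xs))

module _ {n : ℕ} where

  _≟ₛ_ : DecidableEquality (Subset n)
  _≟ₛ_ = ≡-dec _≟ᵇ_

  ⊈⇒∃∈∉ : ∀ {p q : Subset n} → p ⊈ q → ∃ λ x → x ∈ p × x ∉ q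
  ⊈⇒∃∈∉ {p} {q} p⊈q = decidable-stable (any? λ x → (x ∈? p) ×-dec ¬? (x ∈? q)) λ ∄x →
    p⊈q λ {x} x∈p → decidable-stable (x ∈? q) λ x∉q → ∄x (x , x∈p , x∉q)

  p⊆q∧∣p∣≡∣q∣⇒p≡q : ∀ {p q : Subset n} → p ⊆ q → ∣ p ∣ ≡ ∣ q ∣ → p ≡ q
  p⊆q∧∣p∣≡∣q∣⇒p≡q {p} {q} p⊆q ∣p∣≡∣q∣ = ⊆-antisym p⊆q (decidable-stable (q ⊆? p) λ q⊈p →
    let x , x∈q , x∉p = ⊈⇒∃∈∉ q⊈p in <-irrefl ∣p∣≡∣q∣ (p⊂q⇒∣p∣<∣q∣ (p⊆q , x , x∈q , x∉p)))

module _ {A : Set} {f g : A → ℕ} where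

  sum-map-mono-≤ : ∀ xs → (∀ {x} → x ∈ₗ xs → f x ≤ g x) → sum (map f xs) ≤ sum (map g xs)
  sum-map-mono-≤ []       _   = z≤n
  sum-map-mono-≤ (x ∷ xs) f≤g = +-mono-≤ (f≤g (here refl)) (sum-map-mono-≤ xs (f≤g ∘ there))

  sum-map-mono-< : ∀ {xs} → (∀ {x} → x ∈ₗ xs → f x ≤ g x) →
                   ∀ {y} → y ∈ₗ xs → f y < g y → sum (map f xs) < sum (map g xs)
  sum-map-mono-< {x ∷ xs} f≤g (here refl) fy<gy = +-mono-<-≤ fy<gy (sum-map-mono-≤ xs (f≤g ∘ there))
  sum-map-mono-< {x ∷ xs} f≤g (there y∈xs) fy<gy =
    +-mono-≤-< (f≤g (here refl)) (sum-map-mono-< (f≤g ∘ there) y∈xs fy<gy)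

module _ {n : ℕ} {d d′ : Fin n → Fin n → ℕ} (d≤d′ : ∀ {u w} → u <ᶠ w → d u w ≤ d′ u w) where

  private
    above : Fin n → List (Fin n)
    above u = filter (u <?_) (allFin n)

    ∈above⇒> : ∀ {u w} → w ∈ₗ above u → u <ᶠ w
    ∈above⇒> {u} = proj₂ ∘ ∈-filter⁻ (u <?_) {xs = allFin n}

    row≤ : ∀ u → sum (map (d u) (above u)) ≤ sum (map (d′ u) (above u))
    row≤ u = sum-map-mono-≤ (above u) (d≤d′ ∘ ∈above⇒>)

    wiener-mono-<ᶠ : ∀ {u w} → u <ᶠ w → d u w < d′ u w → wiener d < wiener d′
    wiener-mono-<ᶠ {u} {w} u<w d<d′ = sum-map-mono-< (λ {v} _ → row≤ v) (∈-allFin u)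
      (sum-map-mono-< (d≤d′ ∘ ∈above⇒>) (∈-filter⁺ (u <?_) (∈-allFin w) u<w) d<d′)

  wiener-mono-≤ : wiener d ≤ wiener d′
  wiener-mono-≤ = sum-map-mono-≤ (allFin n) (λ {u} _ → row≤ u)

  wiener-mono-< : ∀ {u w} → u ≢ w → d u w < d′ u w → d w u < d′ w u → wiener d < wiener d′
  wiener-mono-< {u} {w} u≢w duw< dwu< with <-cmp u w
  ... | tri< u<w _ _ = wiener-mono-<ᶠ u<w duw<
  ... | tri≈ _ u≡w _ = contradiction u≡w u≢w
  ... | tri> _ _ w<u = wiener-mono-<ᶠ w<u dwu<

indicator : {A : Set} → Dec A → ℕ
indicator a = if does a then 1 else 0

-- The distance in the hypergraph with edges S, f, ∁ S, when f meets both S and ∁ S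
-- (it is 1, not 0, on the diagonal, which the Wiener index never looks at).
skeletonDistance : ∀ {n} → Subset n → Subset n → Fin n → Fin n → ℕ
skeletonDistance S f u w =
  if does (u ∈? S) xor does (w ∈? S) then 3 ∸ (indicator (u ∈? f) + indicator (w ∈? f)) else 1

skeletonDistance≤3 : ∀ {n} (S f : Subset n) u w → skeletonDistance S f u w ≤ 3
skeletonDistance≤3 S f u w with does (u ∈? S) xor does (w ∈? S)
... | true  = m∸n≤m 3 (indicator (u ∈? f) + indicator (w ∈? f))
... | false = s≤s z≤n

-- 12 pairs on a common side at distance 1; across, with a = ∣ S ∩ f ∣ and b = 4 − a,
-- the distances add up to a b + 2 (a (4 − b) + b (4 − a)) + 3 (4 − a) (4 − b) = 32.
wiener-skeletonDistance : ∀ (S f : Subset 8) → ∣ S ∣ ≡ 4 → ∣ f ∣ ≡ 4 → wiener (skeletonDistance S f) ≡ 44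
wiener-skeletonDistance S f ∣S∣≡4 ∣f∣≡4 = decidable-stable (wiener (skeletonDistance S f) ≟ 44) λ W≢44 →
  no-counterexample (S , ∣S∣≡4 , f , ∣f∣≡4 , W≢44)
  where
  no-counterexample : ¬ ∃ λ S → ∣ S ∣ ≡ 4 × ∃ λ f → ∣ f ∣ ≡ 4 × wiener (skeletonDistance S f) ≢ 44
  no-counterexample = toWitnessFalse {a? = anySubset? λ S → (∣ S ∣ ≟ 4) ×-dec anySubset? λ f →
    (∣ f ∣ ≟ 4) ×-dec ¬? (wiener (skeletonDistance S f) ≟ 44)} _

record Skeleton {n} (H : Hypergraph n) (S f : Subset n) : Set where
  field
    S∈H  : S ∈ₗ edges H
    f∈H  : f ∈ₗ edges H
    ∁S∈H : ∁ S ∈ₗ edges H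
    x y  : Fin n
    x∈S  : x ∈ S
    x∈f  : x ∈ f
    y∉S  : y ∉ S
    y∈f  : y ∈ f

  skeletonEdges : List (Subset n)
  skeletonEdges = S ∷ f ∷ ∁ S ∷ []

  skeletonEdges⊆edges : skeletonEdges ⊆ₗ edges H
  skeletonEdges⊆edges (here refl)                 = S∈H
  skeletonEdges⊆edges (there (here refl))         = f∈H
  skeletonEdges⊆edges (there (there (here refl))) = ∁S∈H

  skeletonEdges-unique : Unique skeletonEdges
  skeletonEdges-unique = (S≢f All.∷ S≢∁S All.∷ All.[]) ∷ (f≢∁S All.∷ All.[]) ∷ All.[] ∷ []
    where
    S≢f : S ≢ f
    S≢f S≡f = y∉S (subst (y ∈_) (sym S≡f) y∈f)
    S≢∁S : S ≢ ∁ S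
    S≢∁S S≡∁S = x∈p⇒x∉∁p x∈S (subst (x ∈_) S≡∁S x∈S)
    f≢∁S : f ≢ ∁ S
    f≢∁S f≡∁S = x∈p⇒x∉∁p x∈S (subst (x ∈_) f≡∁S x∈f)

module SkeletonDistance {n k} {H : Hypergraph n} (uniform : IsUniform k H)
  {d : Fin n → Fin n → ℕ} (isDistance : IsDistance H d) (d≤3 : ∀ u w → d u w ≤ 3)
  {S f : Subset n} (skeleton : Skeleton H S f) where

  open Skeleton skeleton

  private
    δ : Fin n → Fin n → ℕ
    δ = skeletonDistance S f

    d≤1 : ∀ {u w} → Adj H u w → d u w ≤ 1
    d≤1 uw = proj₂ (isDistance _ _) 1 (step uw here)

    d≤2 : ∀ {u v w} → Adj H u v → Adj H v w → d u w ≤ 2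
    d≤2 uv vw = proj₂ (isDistance _ _) 2 (step uv (step vw here))

    adj-sym : ∀ {u w} → Adj H u w → Adj H w u
    adj-sym (e , e∈H , u∈e , w∈e) = e , e∈H , w∈e , u∈e

    viaS : ∀ {u w} → u ∈ S → w ∈ S → Adj H u w
    viaS u∈S w∈S = S , S∈H , u∈S , w∈S

    viaf : ∀ {u w} → u ∈ f → w ∈ f → Adj H u w
    viaf u∈f w∈f = f , f∈H , u∈f , w∈f

    via∁S : ∀ {u w} → u ∉ S → w ∉ S → Adj H u w
    via∁S u∉S w∉S = ∁ S , ∁S∈H , x∉p⇒x∈∁p u∉S , x∉p⇒x∈∁p w∉S

  d≤skeleton : ∀ u w → d u w ≤ δ u w
  d≤skeleton u w with u ∈? S | w ∈? S | u ∈? f | w ∈? f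
  ... | yes u∈S | yes w∈S | _       | _       = d≤1 (viaS u∈S w∈S)
  ... | no u∉S  | no w∉S  | _       | _       = d≤1 (via∁S u∉S w∉S)
  ... | yes _   | no _    | yes u∈f | yes w∈f = d≤1 (viaf u∈f w∈f)
  ... | yes _   | no w∉S  | yes u∈f | no _    = d≤2 (viaf u∈f y∈f) (via∁S y∉S w∉S)
  ... | yes u∈S | no _    | no _    | yes w∈f = d≤2 (viaS u∈S x∈S) (viaf x∈f w∈f)
  ... | yes _   | no _    | no _    | no _    = d≤3 u w
  ... | no _    | yes _   | yes u∈f | yes w∈f = d≤1 (viaf u∈f w∈f)
  ... | no _    | yes w∈S | yes u∈f | no _    = d≤2 (viaf u∈f x∈f) (viaS x∈S w∈S)
  ... | no u∉S  | yes _   | no _    | yes w∈f = d≤2 (via∁S u∉S y∉S) (viaf y∈f w∈f)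
  ... | no _    | yes _   | no _    | no _    = d≤3 u w

  module _ (edges⊆skeletonEdges : edges H ⊆ₗ skeletonEdges) where

    crossing-adj⇒∈f : ∀ {u w} → Adj H u w → u ∈ S → w ∉ S → u ∈ f × w ∈ f
    crossing-adj⇒∈f (e , e∈H , u∈e , w∈e) u∈S w∉S with edges⊆skeletonEdges e∈H
    ... | here refl                 = contradiction w∈e w∉S
    ... | there (here refl)         = u∈e , w∈e
    ... | there (there (here refl)) = contradiction u∈e (x∈p⇒x∉∁p u∈S)

    crossing-adj²⇒∈f : ∀ {u v w} → Adj H u v → Adj H v w → u ∈ S → w ∉ S → u ∈ f ⊎ w ∈ f
    crossing-adj²⇒∈f {v = v} uv vw u∈S w∉S with v ∈? S
    ... | yes v∈S = inj₂ (proj₂ (crossing-adj⇒∈f vw v∈S w∉S))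
    ... | no v∉S  = inj₁ (proj₁ (crossing-adj⇒∈f uv u∈S v∉S))

    adj⇒skeleton≤1 : ∀ {u w} → Adj H u w → δ u w ≤ 1
    adj⇒skeleton≤1 {u} {w} uw with u ∈? S | w ∈? S | u ∈? f | w ∈? f
    ... | yes _   | yes _   | _       | _       = ≤-refl
    ... | no _    | no _    | _       | _       = ≤-refl
    ... | yes _   | no _    | yes _   | yes _   = ≤-refl
    ... | no _    | yes _   | yes _   | yes _   = ≤-refl
    ... | yes u∈S | no w∉S  | no u∉f  | _       = contradiction (proj₁ (crossing-adj⇒∈f uw u∈S w∉S)) u∉f
    ... | yes u∈S | no w∉S  | _       | no w∉f  = contradiction (proj₂ (crossing-adj⇒∈f uw u∈S w∉S)) w∉f
    ... | no u∉S  | yes w∈S | no u∉f  | _       =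
      contradiction (proj₂ (crossing-adj⇒∈f (adj-sym uw) w∈S u∉S)) u∉f
    ... | no u∉S  | yes w∈S | _       | no w∉f  =
      contradiction (proj₁ (crossing-adj⇒∈f (adj-sym uw) w∈S u∉S)) w∉f

    adj²⇒skeleton≤2 : ∀ {u v w} → Adj H u v → Adj H v w → δ u w ≤ 2
    adj²⇒skeleton≤2 {u} {v} {w} uv vw with u ∈? S | w ∈? S | u ∈? f | w ∈? f
    ... | yes _   | yes _   | _       | _       = s≤s z≤n
    ... | no _    | no _    | _       | _       = s≤s z≤n
    ... | yes _   | no _    | yes _   | w∈?f    = m∸n≤m 2 (indicator w∈?f)
    ... | no _    | yes _   | yes _   | w∈?f    = m∸n≤m 2 (indicator w∈?f)
    ... | yes _   | no _    | no _    | yes _   = ≤-refl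
    ... | no _    | yes _   | no _    | yes _   = ≤-refl
    ... | yes u∈S | no w∉S  | no u∉f  | no w∉f  = contradiction₂ (crossing-adj²⇒∈f uv vw u∈S w∉S) u∉f w∉f
    ... | no u∉S  | yes w∈S | no u∉f  | no w∉f  =
      contradiction₂ (crossing-adj²⇒∈f (adj-sym vw) (adj-sym uv) w∈S u∉S) w∉f u∉f

    skeleton≤d : ∀ {u w} → u ≢ w → δ u w ≤ d u w
    skeleton≤d {u} {w} u≢w with d u w | proj₁ (isDistance u w)
    ... | zero              | here                   = contradiction refl u≢w
    ... | suc zero          | step uw here           = adj⇒skeleton≤1 uw
    ... | suc (suc zero)    | step uv (step vw here) = adj²⇒skeleton≤2 uv vw
    ... | suc (suc (suc _)) | _                      = ≤-trans (skeletonDistance≤3 S f u w) (s≤s (s≤s (s≤s z≤n)))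

  crossing⇒2≤skeleton : ∀ {u w} → u ∈ S → w ∉ S → u ∉ f ⊎ w ∉ f → 2 ≤ δ u w × 2 ≤ δ w u
  crossing⇒2≤skeleton {u} {w} u∈S w∉S u∉f⊎w∉f with u ∈? S | w ∈? S | u ∈? f | w ∈? f
  ... | no u∉S | _       | _       | _       = contradiction u∈S u∉S
  ... | _      | yes w∈S | _       | _       = contradiction w∈S w∉S
  ... | yes _  | no _    | yes u∈f | yes w∈f = contradiction₂ u∉f⊎w∉f (contradiction u∈f) (contradiction w∈f)
  ... | yes _  | no _    | yes _   | no _    = ≤-refl , ≤-refl
  ... | yes _  | no _    | no _    | yes _   = ≤-refl , ≤-refl
  ... | yes _  | no _    | no _    | no _    = s≤s (s≤s z≤n) , s≤s (s≤s z≤n)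

  extra-edge⇒crossing : ∀ {h} → h ∈ₗ edges H → h ⊈ S → h ⊈ f → h ⊈ ∁ S →
                        ∃₂ λ a b → a ∈ S × b ∉ S × (a ∉ f ⊎ b ∉ f) × Adj H a b
  extra-edge⇒crossing {h} h∈H h⊈S h⊈f h⊈∁S with ⊈⇒∃∈∉ h⊈f
  ... | z , z∈h , z∉f with z ∈? S
  ... | yes z∈S = let b , b∈h , b∉S = ⊈⇒∃∈∉ h⊈S in
                  z , b , z∈S , b∉S , inj₁ z∉f , (h , h∈H , z∈h , b∈h)
  ... | no z∉S  = let a , a∈h , a∉∁S = ⊈⇒∃∈∉ h⊈∁S in
                  a , z , x∉∁p⇒x∈p a∉∁S , z∉S , inj₂ z∉f , (h , h∈H , a∈h , z∈h)

  wiener≤skeleton : wiener d ≤ wiener δ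
  wiener≤skeleton = wiener-mono-≤ (λ {u} {w} _ → d≤skeleton u w)

  extra-edge⇒wiener<skeleton : ∀ {h} → h ∈ₗ edges H → h ⊈ S → h ⊈ f → h ⊈ ∁ S → wiener d < wiener δ
  extra-edge⇒wiener<skeleton h∈H h⊈S h⊈f h⊈∁S =
    let a , b , a∈S , b∉S , a∉f⊎b∉f , ab = extra-edge⇒crossing h∈H h⊈S h⊈f h⊈∁S
        2≤δab , 2≤δba = crossing⇒2≤skeleton a∈S b∉S a∉f⊎b∉f
    in wiener-mono-< (λ {u} {w} _ → d≤skeleton u w) (λ a≡b → b∉S (subst (_∈ S) a≡b a∈S))
         (≤-trans (s≤s (d≤1 ab)) 2≤δab) (≤-trans (s≤s (d≤1 (adj-sym ab))) 2≤δba)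

  wiener≡skeleton⇔edges⊆skeletonEdges : wiener d ≡ wiener δ ⇔ edges H ⊆ₗ skeletonEdges
  wiener≡skeleton⇔edges⊆skeletonEdges = mk⇔ wiener≡⇒edges⊆ edges⊆⇒wiener≡
    where
    open DecMembership _≟ₛ_ using () renaming (_∈?_ to _∈ₗ?_)

    ⊆⇒≡ : ∀ {h e} → h ∈ₗ edges H → e ∈ₗ edges H → h ⊆ e → h ≡ e
    ⊆⇒≡ h∈H e∈H h⊆e =
      p⊆q∧∣p∣≡∣q∣⇒p≡q h⊆e (trans (All.lookup uniform h∈H) (sym (All.lookup uniform e∈H)))

    wiener≡⇒edges⊆ : wiener d ≡ wiener δ → edges H ⊆ₗ skeletonEdges
    wiener≡⇒edges⊆ W≡ {h} h∈H = decidable-stable (h ∈ₗ? skeletonEdges) λ h∉ →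
      <-irrefl W≡ (extra-edge⇒wiener<skeleton h∈H
        (λ h⊆S → h∉ (here (⊆⇒≡ h∈H S∈H h⊆S)))
        (λ h⊆f → h∉ (there (here (⊆⇒≡ h∈H f∈H h⊆f))))
        (λ h⊆∁S → h∉ (there (there (here (⊆⇒≡ h∈H ∁S∈H h⊆∁S))))))

    edges⊆⇒wiener≡ : edges H ⊆ₗ skeletonEdges → wiener d ≡ wiener δ
    edges⊆⇒wiener≡ edges⊆ = ≤-antisym wiener≤skeleton (wiener-mono-≤ (skeleton≤d edges⊆ ∘ <⇒≢))

diametral-skeleton : ∀ k {H : Hypergraph (k + k)} → IsUniform k H →
                     ∀ {d} → IsDistance H d → ∀ {u₀ w₀} → d u₀ w₀ ≡ 3 → ∃₂ λ S f → Skeleton H S f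
diametral-skeleton k {H} uniform {d} isDistance {u₀} {w₀} d≡3
  with subst (Walk H u₀ w₀) d≡3 (proj₁ (isDistance u₀ w₀))
... | step (e₁ , e₁∈H , u₀∈e₁ , x∈e₁) (step (e₂ , e₂∈H , x∈e₂ , y∈e₂) (step (e₃ , e₃∈H , y∈e₃ , w₀∈e₃) here)) =
  e₁ , e₂ , record
    { S∈H = e₁∈H ; f∈H = e₂∈H ; ∁S∈H = subst (_∈ₗ edges H) e₃≡∁e₁ e₃∈H
    ; x∈S = x∈e₁ ; x∈f = x∈e₂ ; y∉S = ∈e₃⇒∉e₁ y∈e₃ ; y∈f = y∈e₂ }
  where
  ∈e₃⇒∉e₁ : ∀ {z} → z ∈ e₃ → z ∉ e₁
  ∈e₃⇒∉e₁ z∈e₃ z∈e₁ = <-irrefl refl (subst (_≤ 2) d≡3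
    (proj₂ (isDistance u₀ w₀) 2 (step (e₁ , e₁∈H , u₀∈e₁ , z∈e₁) (step (e₃ , e₃∈H , z∈e₃ , w₀∈e₃) here))))

  e₃≡∁e₁ : e₃ ≡ ∁ e₁
  e₃≡∁e₁ = p⊆q∧∣p∣≡∣q∣⇒p≡q (x∉p⇒x∈∁p ∘ ∈e₃⇒∉e₁) (begin
    ∣ e₃ ∣         ≡⟨ All.lookup uniform e₃∈H ⟩
    k              ≡⟨ m+n∸n≡m k k ⟨
    k + k ∸ k      ≡⟨ cong (k + k ∸_) (All.lookup uniform e₁∈H) ⟨
    k + k ∸ ∣ e₁ ∣ ≡⟨ ∣∁p∣≡n∸∣p∣ e₁ ⟨
    ∣ ∁ e₁ ∣       ∎)
    where open ≡-Reasoning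

mainTheorem11 : (H : Hypergraph 8) → IsUniform 4 H → Connected H →
    (d : Fin 8 → Fin 8 → ℕ) → IsDistance H d → HasDiameter d 3 →
    (wiener d ≤ 44) × ((wiener d ≡ 44) ⇔ (numEdges H ≡ 3))
mainTheorem11 H uniform _ d isDistance (d≤3 , _ , _ , d≡3) with diametral-skeleton 4 uniform isDistance d≡3
... | S , f , skeleton =
  subst (wiener d ≤_) W₀≡44 wiener≤skeleton , ⇔-trans W≡44⇔edges⊆ edges⊆⇔numEdges≡3
  where
  open Skeleton skeleton
  open SkeletonDistance uniform isDistance d≤3 skeleton

  W₀≡44 : wiener (skeletonDistance S f) ≡ 44
  W₀≡44 = wiener-skeletonDistance S f (All.lookup uniform S∈H) (All.lookup uniform f∈H)

  W≡44⇔edges⊆ : (wiener d ≡ 44) ⇔ (edges H ⊆ₗ skeletonEdges)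
  W≡44⇔edges⊆ = subst (λ W₀ → (wiener d ≡ W₀) ⇔ (edges H ⊆ₗ skeletonEdges)) W₀≡44
    wiener≡skeleton⇔edges⊆skeletonEdges

  edges⊆⇔numEdges≡3 : (edges H ⊆ₗ skeletonEdges) ⇔ (numEdges H ≡ 3)
  edges⊆⇔numEdges≡3 = ⇔-sym (Unique-⊇⇒length≡⇔⊆ _≟ₛ_ (distinct H) skeletonEdges-unique skeletonEdges⊆edges)
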